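{- For non-negative integers $n$, $r$ and $s$ with $s<r\le n$, $$\sum_{k=r}^{n}(-q^{s})^{k-r}\cdot([k-s-1]_q)_{k-r}\cdot S_q[n,k]=\sum_{i=r-1}^{n-1}S_q[i,r-1]\cdot[s]_q^{\,n-i-1}.$$
   Context: For $k\ge1$, $[k]_q=1+q+\cdots+q^{k-1}$ and $[0]_q=0$; powers follow the convention $x^0=1$ (so $[0]_q^0=1$). The $q$-lower factorial is $([m]_q)_j=[m]_q[m-1]_q\cdots[m-j+1]_q$ (a product of $j$ factors, equal to $1$ when $j=0$). The $q$-Stirling numbers of the second kind are defined by $S_q[n,0]=\delta_{n,0}$, $S_q[0,k]=\delta_{0,k}$ and $S_q[n,k]=S_q[n-1,k-1]+[k]_q S_q[n-1,k]$ for $n,k\ge1$; equivalently $S_q[n,k]=\sum_{w\in RG(n,k)}q^{\sum_i(w_i-1)-\binom k2}$, where $RG(n,k)$ is the set of words $w_1\cdots w_n$ of positive integers with maximal entry $k$ such that $w_i\le\max(0,w_1,\dots,w_{i-1})+1$ for all $i$ ($RG(0,0)$ consisting of the empty word). -}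

module Defs where

open import Level using (Level)
open import Data.Nat as ℕ using (ℕ; zero; suc; _∸_)
open import Algebra.Bundles using (CommutativeRing)

-- All q-analogues are interpreted in an arbitrary commutative ring R at an
-- arbitrary element q : Carrier R (a polynomial identity in q over ℤ holds
-- iff it holds for every commutative ring and every element, e.g. in ℤ[q]).
module QDefs {c ℓ : Level} (R : CommutativeRing c ℓ) where
  open CommutativeRing R

  pow : Carrier → ℕ → Carrier
  pow x zero    = 1#
  pow x (suc n) = x * pow x n

  sumBelow : ℕ → (ℕ → Carrier) → Carrier
  sumBelow zero    f = 0#
  sumBelow (suc n) f = sumBelow n f + f n

  -- Σ_{k=a}^{b} f k  (empty, i.e. 0, when b < a)
  sumFromTo : ℕ → ℕ → (ℕ → Carrier) → Carrier
  sumFromTo a b f = sumBelow (suc b ∸ a) (λ j → f (a ℕ.+ j))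

  qint : Carrier → ℕ → Carrier
  qint q k = sumBelow k (λ j → pow q j)

  -- ([m]_q)_j = [m]_q [m-1]_q ... [m-j+1]_q  (j factors; 1 when j = 0)
  -- Only used with j ≤ m in the statement, so the truncated subtraction is harmless.
  qfalling : Carrier → ℕ → ℕ → Carrier
  qfalling q m zero    = 1#
  qfalling q m (suc j) = qint q m * qfalling q (m ∸ 1) j

  Sq : Carrier → ℕ → ℕ → Carrier
  Sq q zero    zero    = 1#
  Sq q zero    (suc k) = 0#
  Sq q (suc n) zero    = 0#
  Sq q (suc n) (suc k) = Sq q n k + qint q (suc k) * Sq q n (suc k)

-- Write r = p + 1 with p = s + a, and put x = q^s and
-- d_j = (-x)^j ([a+j]_q)_j, so the left side is Σ_j d_j S_q[n, p+1+j].
-- Since [s+a+j+1]_q = [s]_q + x [a+j+1]_q, the weights satisfy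
-- d_{j+1} + d_j [p+1+j]_q = [s]_q d_j, and feeding this into the Stirling
-- recurrence shows that L(n) = Σ_j d_j S_q[n, p+1+j] obeys
-- L(n+1) = S_q[n,p] + [s]_q L(n) with L(p+1) = 1, which unrolls to the right side.
module Submission where

open import Defs
open import Level using (Level)
open import Data.Nat as ℕ using (ℕ; zero; suc; _∸_; _<_; _≤_; s≤s)
open import Algebra.Bundles using (CommutativeRing)
import Data.Nat.Properties as ℕₚ
open import Data.Product using (_,_)
import Relation.Binary.PropositionalEquality as ≡

module QIdentities {c ℓ : Level} (R : CommutativeRing c ℓ) where
  open CommutativeRing R
  open QDefs R
  open import Relation.Binary.Reasoning.Setoid setoid
  open import Algebra.Solver.Ring.NaturalCoefficients.Default commutativeSemiring
  open import Algebra.Properties.CommutativeSemigroup *-commutativeSemigroup using (x∙yz≈y∙xz)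

  sumBelow-cong : ∀ M {f g : ℕ → Carrier} → (∀ j → j < M → f j ≈ g j) →
                  sumBelow M f ≈ sumBelow M g
  sumBelow-cong zero    f≈g = refl
  sumBelow-cong (suc M) f≈g =
    +-cong (sumBelow-cong M (λ j j<M → f≈g j (ℕₚ.m<n⇒m<1+n j<M))) (f≈g M (ℕₚ.n<1+n M))

  *-distribˡ-sumBelow : ∀ M x (f : ℕ → Carrier) →
                        x * sumBelow M f ≈ sumBelow M (λ j → x * f j)
  *-distribˡ-sumBelow zero    x f = zeroʳ x
  *-distribˡ-sumBelow (suc M) x f =
    trans (distribˡ x _ _) (+-cong (*-distribˡ-sumBelow M x f) refl)

  sumBelow-+ : ∀ m n (f : ℕ → Carrier) →
               sumBelow (m ℕ.+ n) f ≈ sumBelow m f + sumBelow n (λ j → f (m ℕ.+ j))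
  sumBelow-+ m zero    f rewrite ℕₚ.+-identityʳ m = sym (+-identityʳ _)
  sumBelow-+ m (suc n) f rewrite ℕₚ.+-suc m n =
    trans (+-cong (sumBelow-+ m n f) refl) (+-assoc _ _ _)

  sumFromTo-+ : ∀ a m (f : ℕ → Carrier) →
                sumFromTo a (a ℕ.+ m) f ≡.≡ sumBelow (suc m) (λ j → f (a ℕ.+ j))
  sumFromTo-+ a m f = ≡.cong (λ L → sumBelow L (λ j → f (a ℕ.+ j)))
    (≡.trans (≡.cong (_∸ a) (≡.sym (ℕₚ.+-suc a m))) (ℕₚ.m+n∸m≡n a (suc m)))

  horner-step : ∀ m x (f : ℕ → Carrier) →
                x * sumBelow (suc m) (λ i → f i * pow x (m ∸ i)) + f (suc m)
                ≈ sumBelow (suc (suc m)) (λ i → f i * pow x (suc m ∸ i))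
  horner-step m x f = +-cong
    (trans (*-distribˡ-sumBelow (suc m) x _) (sumBelow-cong (suc m) pull-x))
    (trans (sym (*-identityʳ _)) (*-cong refl (reflexive (≡.cong (pow x) (≡.sym (ℕₚ.n∸n≡0 m))))))
    where
    pull-x : ∀ i → i < suc m → x * (f i * pow x (m ∸ i)) ≈ f i * pow x (suc m ∸ i)
    pull-x i (s≤s i≤m) = trans (x∙yz≈y∙xz x _ _)
      (*-cong refl (reflexive (≡.cong (pow x) (≡.sym (ℕₚ.+-∸-assoc 1 i≤m)))))

  pow-+ : ∀ x m n → pow x (m ℕ.+ n) ≈ pow x m * pow x n
  pow-+ x zero    n = sym (*-identityˡ _)
  pow-+ x (suc m) n = trans (*-cong refl (pow-+ x m n)) (sym (*-assoc _ _ _))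

  qint-+ : ∀ q m n → qint q (m ℕ.+ n) ≈ qint q m + pow q m * qint q n
  qint-+ q m n = begin
    qint q (m ℕ.+ n)                                  ≈⟨ sumBelow-+ m n (pow q) ⟩
    qint q m + sumBelow n (λ j → pow q (m ℕ.+ j))     ≈⟨ +-cong refl (sumBelow-cong n (λ j _ → pow-+ q m j)) ⟩
    qint q m + sumBelow n (λ j → pow q m * pow q j)   ≈⟨ +-cong refl (sym (*-distribˡ-sumBelow n _ _)) ⟩
    qint q m + pow q m * qint q n                     ∎

  Sq-vanish : ∀ q n k → n < k → Sq q n k ≈ 0#
  Sq-vanish q zero    (suc k) _         = refl
  Sq-vanish q (suc n) (suc k) (s≤s n<k) = trans
    (+-cong (Sq-vanish q n k n<k)
            (trans (*-cong refl (Sq-vanish q n (suc k) (ℕₚ.m<n⇒m<1+n n<k))) (zeroʳ _)))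
    (+-identityʳ 0#)

  Sq-diag : ∀ q n → Sq q n n ≈ 1#
  Sq-diag q zero    = refl
  Sq-diag q (suc n) = trans
    (+-cong (Sq-diag q n) (trans (*-cong refl (Sq-vanish q n (suc n) (ℕₚ.n<1+n n))) (zeroʳ _)))
    (+-identityʳ _)

  module StirlingTransform
    (q : Carrier) (p : ℕ) (c : Carrier) (w : ℕ → Carrier)
    (w-step : ∀ j → w (suc j) + w j * qint q (suc p ℕ.+ j) ≈ c * w j)
    where

    transform : ℕ → ℕ → Carrier
    transform n M = sumBelow M (λ j → w j * Sq q n (suc p ℕ.+ j))

    transform-step : ∀ n M → transform (suc n) (suc M)
      ≈ w 0 * Sq q n p + c * transform n M + w M * qint q (suc p ℕ.+ M) * Sq q n (suc p ℕ.+ M)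
    transform-step n zero rewrite ℕₚ.+-identityʳ p =
      solve 5 (λ W S Q S′ C → con 0 :+ W :* (S :+ Q :* S′) := W :* S :+ C :* con 0 :+ W :* Q :* S′)
        refl (w 0) (Sq q n p) (qint q (suc p)) (Sq q n (suc p)) c
    transform-step n (suc M) rewrite ℕₚ.+-suc p M = begin
      transform (suc n) (suc M) + W′ * (S + Q′ * S′)
        ≈⟨ +-cong (transform-step n M) refl ⟩
      (W₀ * A + c * T + W * Q * S) + W′ * (S + Q′ * S′)
        ≈⟨ solve 10 (λ W₀ A C T W Q S W′ Q′ S′ →
             (W₀ :* A :+ C :* T :+ W :* Q :* S) :+ W′ :* (S :+ Q′ :* S′)
             := W₀ :* A :+ C :* T :+ (W′ :+ W :* Q) :* S :+ W′ :* Q′ :* S′)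
           refl W₀ A c T W Q S W′ Q′ S′ ⟩
      W₀ * A + c * T + (W′ + W * Q) * S + W′ * Q′ * S′
        ≈⟨ +-cong (+-cong refl (*-cong (w-step M) refl)) refl ⟩
      W₀ * A + c * T + (c * W) * S + W′ * Q′ * S′
        ≈⟨ +-cong (solve 5 (λ W₀A C T W S → W₀A :+ C :* T :+ (C :* W) :* S := W₀A :+ C :* (T :+ W :* S))
                     refl (W₀ * A) c T W S) refl ⟩
      W₀ * A + c * transform n (suc M) + W′ * Q′ * S′ ∎
      where
      W₀ = w 0
      A  = Sq q n p
      T  = transform n M
      W  = w M
      W′ = w (suc M)
      Q  = qint q (suc p ℕ.+ M)
      S  = Sq q n (suc p ℕ.+ M)
      Q′ = qint q (suc (suc p ℕ.+ M))
      S′ = Sq q n (suc (suc p ℕ.+ M))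

    transform-closed : ∀ m → transform (suc p ℕ.+ m) (suc m)
      ≈ w 0 * sumBelow (suc m) (λ i → Sq q (p ℕ.+ i) p * pow c (m ∸ i))
    transform-closed zero rewrite ℕₚ.+-identityʳ p = begin
      0# + w 0 * Sq q (suc p) (suc p)   ≈⟨ +-cong refl (*-cong refl (Sq-diag q (suc p))) ⟩
      0# + w 0 * 1#                     ≈⟨ solve 1 (λ W → con 0 :+ W :* con 1 := W :* (con 0 :+ con 1 :* con 1)) refl (w 0) ⟩
      w 0 * (0# + 1# * 1#)              ≈⟨ *-cong refl (+-cong refl (*-cong (sym (Sq-diag q p)) refl)) ⟩
      w 0 * (0# + Sq q p p * 1#)        ∎
    transform-closed (suc m) = begin
      transform (suc p ℕ.+ suc m) (suc (suc m))
        ≈⟨ transform-step (p ℕ.+ suc m) (suc m) ⟩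
      W₀ * S + c * transform (p ℕ.+ suc m) (suc m) + boundary
        ≈⟨ +-cong (+-cong refl (*-cong refl (reflexive reindex))) boundary≈0 ⟩
      W₀ * S + c * transform (suc p ℕ.+ m) (suc m) + 0#
        ≈⟨ +-cong (+-cong refl (*-cong refl (transform-closed m))) refl ⟩
      W₀ * S + c * (W₀ * U) + 0#
        ≈⟨ solve 4 (λ W₀ S C U → W₀ :* S :+ C :* (W₀ :* U) :+ con 0 := W₀ :* (C :* U :+ S))
             refl W₀ S c U ⟩
      W₀ * (c * U + S)
        ≈⟨ *-cong refl (horner-step m c (λ i → Sq q (p ℕ.+ i) p)) ⟩
      W₀ * sumBelow (suc (suc m)) (λ i → Sq q (p ℕ.+ i) p * pow c (suc m ∸ i)) ∎
      where
      W₀ = w 0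
      S  = Sq q (p ℕ.+ suc m) p
      U  = sumBelow (suc m) (λ i → Sq q (p ℕ.+ i) p * pow c (m ∸ i))
      boundary = w (suc m) * qint q (suc p ℕ.+ suc m) * Sq q (p ℕ.+ suc m) (suc p ℕ.+ suc m)
      boundary≈0 : boundary ≈ 0#
      boundary≈0 = trans (*-cong refl (Sq-vanish q (p ℕ.+ suc m) _ (ℕₚ.n<1+n _))) (zeroʳ _)
      reindex : transform (p ℕ.+ suc m) (suc m) ≡.≡ transform (suc p ℕ.+ m) (suc m)
      reindex = ≡.cong (λ n → transform n (suc m)) (ℕₚ.+-suc p m)

  falling-weight : Carrier → ℕ → ℕ → ℕ → Carrier
  falling-weight q s a j = pow (- pow q s) j * qfalling q (a ℕ.+ j) j

  falling-weight-step : ∀ q s a j →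
    falling-weight q s a (suc j) + falling-weight q s a j * qint q (suc (s ℕ.+ a) ℕ.+ j)
    ≈ qint q s * falling-weight q s a j
  falling-weight-step q s a j rewrite ℕₚ.+-suc a j = begin
    (- x * P) * (Q * F) + (P * F) * qint q (suc (s ℕ.+ a) ℕ.+ j)
      ≈⟨ +-cong refl (*-cong refl (trans (reflexive (≡.cong (qint q) shift)) (qint-+ q s (suc (a ℕ.+ j))))) ⟩
    (- x * P) * (Q * F) + (P * F) * (qint q s + x * Q)
      ≈⟨ solve 6 (λ y x P Q F Qs → (y :* P) :* (Q :* F) :+ (P :* F) :* (Qs :+ x :* Q)
                  := Qs :* (P :* F) :+ (y :+ x) :* (P :* (Q :* F))) refl (- x) x P Q F (qint q s) ⟩
    qint q s * (P * F) + (- x + x) * (P * (Q * F))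
      ≈⟨ +-cong refl (trans (*-cong (-‿inverseˡ x) refl) (zeroˡ _)) ⟩
    qint q s * (P * F) + 0#
      ≈⟨ +-identityʳ _ ⟩
    qint q s * (P * F) ∎
    where
    x = pow q s
    P = pow (- x) j
    Q = qint q (suc (a ℕ.+ j))
    F = qfalling q (a ℕ.+ j) j
    shift : suc (s ℕ.+ a) ℕ.+ j ≡.≡ s ℕ.+ suc (a ℕ.+ j)
    shift = ≡.trans (≡.cong suc (ℕₚ.+-assoc s a j)) (≡.sym (ℕₚ.+-suc s (a ℕ.+ j)))

  falling-Stirling-sum : ∀ q s a m → let p = s ℕ.+ a; n = suc p ℕ.+ m in
    sumFromTo (suc p) n (λ k → pow (- pow q s) (k ∸ suc p) * qfalling q (k ∸ s ∸ 1) (k ∸ suc p) * Sq q n k)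
    ≈ sumFromTo p (p ℕ.+ m) (λ i → Sq q i p * pow (qint q s) (n ∸ i ∸ 1))
  falling-Stirling-sum q s a m = begin
    sumFromTo (suc p) (suc p ℕ.+ m) f      ≡⟨ sumFromTo-+ (suc p) m f ⟩
    sumBelow (suc m) (λ j → f (suc p ℕ.+ j)) ≈⟨ sumBelow-cong (suc m) (λ j _ → left-term j) ⟩
    transform (suc p ℕ.+ m) (suc m)        ≈⟨ transform-closed m ⟩
    1# * 1# * sumBelow (suc m) U           ≈⟨ trans (*-cong (*-identityˡ 1#) refl) (*-identityˡ _) ⟩
    sumBelow (suc m) U                     ≈⟨ sumBelow-cong (suc m) (λ i _ → right-term i) ⟩
    sumBelow (suc m) (λ i → g (p ℕ.+ i))   ≡⟨ ≡.sym (sumFromTo-+ p m g) ⟩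
    sumFromTo p (p ℕ.+ m) g                ∎
    where
    p = s ℕ.+ a
    n = suc p ℕ.+ m
    open StirlingTransform q p (qint q s) (falling-weight q s a) (falling-weight-step q s a)
    f g U : ℕ → Carrier
    f k = pow (- pow q s) (k ∸ suc p) * qfalling q (k ∸ s ∸ 1) (k ∸ suc p) * Sq q n k
    g i = Sq q i p * pow (qint q s) (n ∸ i ∸ 1)
    U i = Sq q (p ℕ.+ i) p * pow (qint q s) (m ∸ i)
    falling-index : ∀ j → suc p ℕ.+ j ∸ s ∸ 1 ≡.≡ a ℕ.+ j
    falling-index j = ≡.cong (_∸ 1) (≡.trans (≡.cong (_∸ s) (≡.trans (≡.cong suc (ℕₚ.+-assoc s a j))
      (≡.sym (ℕₚ.+-suc s (a ℕ.+ j))))) (ℕₚ.m+n∸m≡n s (suc (a ℕ.+ j))))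
    left-term : ∀ j → f (suc p ℕ.+ j) ≈ falling-weight q s a j * Sq q n (suc p ℕ.+ j)
    left-term j rewrite ℕₚ.m+n∸m≡n (suc p) j | falling-index j = refl
    power-index : ∀ i → n ∸ (p ℕ.+ i) ∸ 1 ≡.≡ m ∸ i
    power-index i = ≡.trans (≡.cong (_∸ 1) (≡.trans (≡.cong (_∸ (p ℕ.+ i)) (≡.sym (ℕₚ.+-suc p m)))
      (ℕₚ.[m+n]∸[m+o]≡n∸o p (suc m) i))) (≡.trans (ℕₚ.∸-+-assoc (suc m) i 1) (≡.cong (suc m ∸_) (ℕₚ.+-comm i 1)))
    right-term : ∀ i → U i ≈ g (p ℕ.+ i)
    right-term i = *-cong refl (reflexive (≡.cong (pow (qint q s)) (≡.sym (power-index i))))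

theorem10p1 : ∀ {c ℓ} (R : CommutativeRing c ℓ) (q : CommutativeRing.Carrier R)
    (n r s : ℕ) → s < r → r ≤ n →
    let open CommutativeRing R
        open QDefs R
    in sumFromTo r n (λ k → pow (- pow q s) (k ∸ r) * qfalling q (k ∸ s ∸ 1) (k ∸ r) * Sq q n k)
       ≈ sumFromTo (r ∸ 1) (n ∸ 1) (λ i → Sq q i (r ∸ 1) * pow (qint q s) (n ∸ i ∸ 1))
theorem10p1 R q n (suc p) s (s≤s s≤p) r≤n
  with a , ≡.refl ← ℕₚ.m≤n⇒∃[o]m+o≡n s≤p
  with m , ≡.refl ← ℕₚ.m≤n⇒∃[o]m+o≡n r≤n
  = QIdentities.falling-Stirling-sum R q s a m
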